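{- Let $n=p_1^{\alpha_1}\cdots p_k^{\alpha_k}$ be the prime power factorization of $n$ with $k\ge2$, distinct primes $p_i$ and $\alpha_1\ge\cdots\ge\alpha_k\ge1$, and suppose $n\neq p_1^2p_2$. Let $\alpha_{r_1},\dots,\alpha_{r_b}$ be the distinct values among $\alpha_1,\dots,\alpha_k$, and for $1\le i\le b$ let $k_i=|\{j\in\{1,\dots,k\}:\alpha_j=\alpha_{r_i}\}|$. Then $\mathrm{Aut}(\Upsilon_n)\cong S_{k_1}\times S_{k_2}\times\cdots\times S_{k_b}$, where $S_m$ denotes the symmetric group on $m$ letters.
   Context: For an integer $n>1$, a proper divisor of $n$ is an integer $d$ with $1<d<n$ and $d\mid n$. The proper divisor graph $\Upsilon_n$ is the simple graph whose vertices are the proper divisors of $n$, two distinct vertices $u,v$ being adjacent iff $n\mid uv$. $\mathrm{Aut}(G)$ denotes the automorphism group of a graph $G$. -}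

module Defs where

open import Data.Nat using (ℕ; _*_; _<_; _^_; _<?_)
open import Data.Nat.Divisibility using (_∣_; _∣?_)
open import Data.Nat.ListAction using (product)
open import Data.Fin using (Fin)
open import Data.List using (List; map; length; filter; allFin)
open import Data.Product using (Σ; Σ-syntax; _×_; _,_; proj₁)
open import Data.Unit using (⊤)
open import Relation.Nullary using (¬_)
open import Relation.Nullary.Decidable using (Dec; True; _×-dec_)
open import Relation.Binary.PropositionalEquality using (_≡_; _≢_; cong; trans)
open import Function.Bundles using (_↔_; _⇔_; Inverse; Equivalence; mk⇔)
import Data.Nat as ℕ

ProperDivisor : ℕ → ℕ → Set
ProperDivisor n d = (1 < d) × (d < n) × (d ∣ n)

properDivisor? : (n d : ℕ) → Dec (ProperDivisor n d)
properDivisor? n d = (1 <? d) ×-dec ((d <? n) ×-dec (d ∣? n))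

-- Vertex set of Υ_n (the proof component is the proof-irrelevant `True`)
Vertex : ℕ → Set
Vertex n = Σ[ d ∈ ℕ ] True (properDivisor? n d)

Adj : (n : ℕ) → Vertex n → Vertex n → Set
Adj n u v = (proj₁ u ≢ proj₁ v) × (n ∣ proj₁ u * proj₁ v)

record Aut (n : ℕ) : Set where
  field
    to       : Vertex n → Vertex n
    from     : Vertex n → Vertex n
    to-from  : ∀ v → to (from v) ≡ v
    from-to  : ∀ v → from (to v) ≡ v
    preserve : ∀ u v → Adj n u v ⇔ Adj n (to u) (to v)

open Aut

_≈ᴬ_ : {n : ℕ} → Aut n → Aut n → Set
_≈ᴬ_ {n} f g = ∀ (v : Vertex n) → to f v ≡ to g v

_∘ᴬ_ : {n : ℕ} → Aut n → Aut n → Aut n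
f ∘ᴬ g = record
  { to      = λ v → to f (to g v)
  ; from    = λ v → from g (from f v)
  ; to-from = λ v → trans (cong (to f) (to-from g (from f v))) (to-from f v)
  ; from-to = λ v → trans (cong (from g) (from-to f (to g v))) (from-to g v)
  ; preserve = λ u v → mk⇔
      (λ a → Equivalence.to (preserve f (to g u) (to g v))
               (Equivalence.to (preserve g u v) a))
      (λ a → Equivalence.from (preserve g u v)
               (Equivalence.from (preserve f (to g u) (to g v)) a))
  }

SymProd : (b : ℕ) → (Fin b → ℕ) → Set
SymProd b ks = (i : Fin b) → Fin (ks i) ↔ Fin (ks i)

_≈ˢ_ : {b : ℕ} {ks : Fin b → ℕ} → SymProd b ks → SymProd b ks → Set
_≈ˢ_ {b} {ks} s t = ∀ (i : Fin b) (x : Fin (ks i)) →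
  Inverse.to (s i) x ≡ Inverse.to (t i) x

_≈ˢ-∘_,_ : {b : ℕ} {ks : Fin b → ℕ} → SymProd b ks → SymProd b ks → SymProd b ks → Set
_≈ˢ-∘_,_ {b} {ks} u s t = ∀ (i : Fin b) (x : Fin (ks i)) →
  Inverse.to (u i) x ≡ Inverse.to (s i) (Inverse.to (t i) x)

record AutIsoSymProd (n b : ℕ) (ks : Fin b → ℕ) : Set where
  field
    φ           : Aut n → SymProd b ks
    φ-cong      : ∀ f g → f ≈ᴬ g → φ f ≈ˢ φ g
    φ-injective : ∀ f g → φ f ≈ˢ φ g → f ≈ᴬ g
    φ-surjective : ∀ (s : SymProd b ks) → Σ[ f ∈ Aut n ] φ f ≈ˢ s
    φ-hom       : ∀ f g → φ (f ∘ᴬ g) ≈ˢ-∘ φ f , φ g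

multiplicity : {k : ℕ} → (Fin k → ℕ) → ℕ → ℕ
multiplicity {k} α a = length (filter (λ j → α j ℕ.≟ a) (allFin k))

-- Write n = ∏ pᵢ ^ αᵢ. A proper divisor of n is the same as an exponent vector e with
-- 0 ≤ e ≤ α, e ≠ 0 and e ≠ α, and two proper divisors are adjacent iff they differ and their
-- exponent vectors add up to at least α; the argument only uses this description.
--
-- The leaves of Υ_n are exactly the primes pᵢ (this is where k ≥ 2 is needed), the unique
-- neighbour of pᵢ being n / pᵢ. So an automorphism σ permutes the leaves and induces a
-- permutation π of the indices. By induction on s, σ maps n / pᵢ ^ s to n / p_{π i} ^ s and
-- αᵢ ≤ α_{π i}: the neighbours of pᵢ ^ (s + 1) are the n / pᵢ ^ t with t ≤ s + 1, and those with
-- t ≤ s are already known to be sent to the neighbours n / p_{π i} ^ t of σ (pᵢ ^ (s + 1)), which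
-- leaves only n / p_{π i} ^ (s + 1) for the image of n / pᵢ ^ (s + 1). The argument breaks down
-- only when pᵢ ^ (s + 1) is itself some n / pⱼ, and then either π fixes i or n = pᵢ² pⱼ.
-- Applied to σ⁻¹ this gives α ∘ π = α. Since x ~ n / pᵢ ^ s implies pᵢ ^ s ∣ x, and pᵢ ^ s ∣ x
-- makes x adjacent or equal to n / pᵢ ^ s, σ moves the coordinates of exponent vectors along π.
-- Conversely every α-preserving permutation of the coordinates is an automorphism, so Aut(Υ_n)
-- is the group of permutations of the indices preserving α, the product of the symmetric groups
-- of its fibres.

module Submission where

open import Defs
open import Data.Nat
  using (ℕ; zero; suc; _+_; _*_; _^_; _∸_; _≤_; _<_; z≤n; s≤s; _≟_; _≤?_; _<?_; >-nonZero; nonTrivial⇒≢1)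
open import Data.Nat.Properties
open import Data.Nat.Divisibility
  using (_∣_; _∣?_; divides; ∣-refl; ∣-trans; ∣-reflexive; ∣1⇒≡1; *-pres-∣; m∣m*n; n∣m*n; *-cancelˡ-∣; ∣⇒≤)
open import Data.Nat.Primality
  using (Prime; euclidsLemma; prime⇒irreducible; prime⇒nonZero; prime⇒nonTrivial)
open import Data.Nat.Coprimality using (Coprime; coprime-divisor)
open import Data.Nat.ListAction using (product)
open import Data.Fin using (Fin; toℕ; zero; suc) renaming (_≟_ to _≟ᶠ_)
open import Data.Fin.Properties
  using (any?; all?) renaming (0≢1+n to zero≢suc; suc-injective to fsuc-injective)
open import Data.Bool.Properties using (T-irrelevant)
open import Data.List using (length; filter; map; allFin; tabulate)
open import Data.List.Properties using (map-tabulate)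
open import Data.Vec.Functional using (updateAt)
open import Data.Vec.Functional.Properties using (updateAt-updates; updateAt-minimal)
open import Data.Product using (Σ; Σ-syntax; ∃-syntax; _×_; _,_; proj₁; proj₂)
open import Data.Sum using (_⊎_; inj₁; inj₂; [_,_]′)
open import Data.Empty using (⊥; ⊥-elim)
open import Function using (_∘_; id; _↔_; Inverse; mk↔ₛ′; Equivalence; mk⇔)
open import Function.Construct.Composition using (_↔-∘_)
open import Function.Construct.Symmetry using (↔-sym)
open import Function.Definitions using (Injective)
open import Relation.Nullary using (¬_; Dec; yes; no; contradiction; ¬?; _×-dec_)
open import Relation.Nullary.Decidable using (map′; toWitness; fromWitness)
open import Relation.Unary using (Decidable)
open import Relation.Binary.PropositionalEquality
open import Algebra.Properties.CommutativeMonoid.Sum *-1-commutativeMonoid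
  using (∑-distrib-+; sum-cong-≗) renaming (sum to ∏)

private variable
  k : ℕ

_≤ᵛ_ : (Fin k → ℕ) → (Fin k → ℕ) → Set
a ≤ᵛ b = ∀ i → a i ≤ b i

_^ᵛ_ : (Fin k → ℕ) → (Fin k → ℕ) → ℕ
p ^ᵛ e = ∏ λ i → p i ^ e i

product-map-allFin : (f : Fin k → ℕ) → product (map f (allFin k)) ≡ ∏ f
product-map-allFin f = trans (cong product (map-tabulate id f)) (product-tabulate f)
  where
  product-tabulate : ∀ {k} (f : Fin k → ℕ) → product (tabulate f) ≡ ∏ f
  product-tabulate {zero} f = refl
  product-tabulate {suc k} f = cong (f zero *_) (product-tabulate (f ∘ suc))

^ᵛ-congʳ : (p : Fin k → ℕ) {a b : Fin k → ℕ} → (∀ i → a i ≡ b i) → p ^ᵛ a ≡ p ^ᵛ b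
^ᵛ-congʳ p a≗b = sum-cong-≗ (λ i → cong (p i ^_) (a≗b i))

^ᵛ-distribˡ-+ : (p a b : Fin k → ℕ) → p ^ᵛ (λ i → a i + b i) ≡ p ^ᵛ a * p ^ᵛ b
^ᵛ-distribˡ-+ p a b = trans (sum-cong-≗ (λ i → ^-distribˡ-+-* (p i) (a i) (b i)))
                            (∑-distrib-+ (λ i → p i ^ a i) (λ i → p i ^ b i))

^ᵛ-zeroʳ : (p : Fin k → ℕ) → p ^ᵛ (λ _ → 0) ≡ 1
^ᵛ-zeroʳ {zero} p = refl
^ᵛ-zeroʳ {suc k} p = trans (*-identityˡ _) (^ᵛ-zeroʳ (p ∘ suc))

^-monoʳ-∣ : ∀ q {a b} → a ≤ b → q ^ a ∣ q ^ b
^-monoʳ-∣ q {a} {b} a≤b =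
  divides (q ^ (b ∸ a)) (trans (cong (q ^_) (sym (m∸n+n≡m a≤b))) (^-distribˡ-+-* q (b ∸ a) a))

^ᵛ-monoʳ-∣ : (p : Fin k → ℕ) {a b : Fin k → ℕ} → a ≤ᵛ b → p ^ᵛ a ∣ p ^ᵛ b
^ᵛ-monoʳ-∣ {zero} p a≤b = ∣-refl
^ᵛ-monoʳ-∣ {suc k} p a≤b = *-pres-∣ (^-monoʳ-∣ (p zero) (a≤b zero)) (^ᵛ-monoʳ-∣ (p ∘ suc) (a≤b ∘ suc))

^ᵛ-positive : {p : Fin k → ℕ} → (∀ i → Prime (p i)) → (e : Fin k → ℕ) → 0 < p ^ᵛ e
^ᵛ-positive {zero} p-prime e = s≤s z≤n
^ᵛ-positive {suc k} {p} p-prime e =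
  *-mono-≤ (m^n>0 (p zero) {{prime⇒nonZero (p-prime zero)}} (e zero)) (^ᵛ-positive (p-prime ∘ suc) (e ∘ suc))

prime≢1 : ∀ {q} → Prime q → q ≢ 1
prime≢1 q-prime = nonTrivial⇒≢1 {{prime⇒nonTrivial q-prime}}

prime∣^⇒≡ : ∀ {q p} e → Prime q → Prime p → q ∣ p ^ e → q ≡ p
prime∣^⇒≡ zero q-prime _ q∣1 = contradiction (∣1⇒≡1 q∣1) (prime≢1 q-prime)
prime∣^⇒≡ {q} {p} (suc e) q-prime p-prime q∣pᵉ⁺¹ with euclidsLemma p (p ^ e) q-prime q∣pᵉ⁺¹
... | inj₂ q∣pᵉ = prime∣^⇒≡ e q-prime p-prime q∣pᵉ
... | inj₁ q∣p with prime⇒irreducible p-prime q∣p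
...   | inj₁ q≡1 = contradiction q≡1 (prime≢1 q-prime)
...   | inj₂ q≡p = q≡p

prime∤^ᵛ : ∀ {q} {p : Fin k → ℕ} → Prime q → (∀ j → Prime (p j)) → (∀ j → q ≢ p j) →
           (e : Fin k → ℕ) → ¬ q ∣ p ^ᵛ e
prime∤^ᵛ {zero} q-prime p-prime q≢p e q∣1 = prime≢1 q-prime (∣1⇒≡1 q∣1)
prime∤^ᵛ {suc k} {p = p} q-prime p-prime q≢p e q∣ with euclidsLemma (p zero ^ e zero) _ q-prime q∣
... | inj₁ q∣head = q≢p zero (prime∣^⇒≡ (e zero) q-prime (p-prime zero) q∣head)
... | inj₂ q∣tail = prime∤^ᵛ q-prime (p-prime ∘ suc) (q≢p ∘ suc) (e ∘ suc) q∣tail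

head∤tail : {p : Fin (suc k) → ℕ} → (∀ j → Prime (p j)) → Injective _≡_ _≡_ p →
            (e : Fin k → ℕ) → ¬ p zero ∣ (p ∘ suc) ^ᵛ e
head∤tail p-prime p-inj = prime∤^ᵛ (p-prime zero) (p-prime ∘ suc) (λ j → zero≢suc ∘ p-inj)

tail-injective : {p : Fin (suc k) → ℕ} → Injective _≡_ _≡_ p → Injective _≡_ _≡_ (p ∘ suc)
tail-injective p-inj = fsuc-injective ∘ p-inj

∤⇒coprime : ∀ {q d} → Prime q → ¬ q ∣ d → Coprime d q
∤⇒coprime q-prime q∤d (c∣d , c∣q) with prime⇒irreducible q-prime c∣q
... | inj₁ c≡1 = c≡1
... | inj₂ refl = contradiction c∣d q∤d

∣^*⇒∣ : ∀ {q d m} s → Prime q → ¬ q ∣ d → d ∣ q ^ s * m → d ∣ m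
∣^*⇒∣ {d = d} {m} zero q-prime q∤d d∣ = subst (d ∣_) (+-identityʳ m) d∣
∣^*⇒∣ {q} {d} {m} (suc s) q-prime q∤d d∣ =
  ∣^*⇒∣ s q-prime q∤d (coprime-divisor (∤⇒coprime q-prime q∤d) (subst (d ∣_) (*-assoc q (q ^ s) m) d∣))

^∣^*⇒≤ : ∀ {q m} a b → Prime q → ¬ q ∣ m → q ^ a ∣ q ^ b * m → a ≤ b
^∣^*⇒≤ zero b q-prime q∤m _ = z≤n
^∣^*⇒≤ {q} {m} (suc a) zero q-prime q∤m qᵃ⁺¹∣m =
  contradiction (∣-trans (m∣m*n (q ^ a)) (subst (q ^ suc a ∣_) (+-identityʳ m) qᵃ⁺¹∣m)) q∤m
^∣^*⇒≤ {q} {m} (suc a) (suc b) q-prime q∤m qᵃ⁺¹∣ =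
  s≤s (^∣^*⇒≤ a b q-prime q∤m
    (*-cancelˡ-∣ q {{prime⇒nonZero q-prime}} (subst (q ^ suc a ∣_) (*-assoc q (q ^ b) m) qᵃ⁺¹∣)))

^ᵛ-cancelʳ-∣ : {p : Fin k → ℕ} → (∀ j → Prime (p j)) → Injective _≡_ _≡_ p →
               (a b : Fin k → ℕ) → p ^ᵛ a ∣ p ^ᵛ b → a ≤ᵛ b
^ᵛ-cancelʳ-∣ {suc k} {p} p-prime p-inj a b pᵃ∣pᵇ zero =
  ^∣^*⇒≤ (a zero) (b zero) (p-prime zero) (head∤tail p-prime p-inj (b ∘ suc))
    (∣-trans (m∣m*n _) pᵃ∣pᵇ)
^ᵛ-cancelʳ-∣ {suc k} {p} p-prime p-inj a b pᵃ∣pᵇ (suc i) =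
  ^ᵛ-cancelʳ-∣ (p-prime ∘ suc) (tail-injective p-inj) (a ∘ suc) (b ∘ suc)
    (∣^*⇒∣ (b zero) (p-prime zero) (head∤tail p-prime p-inj (a ∘ suc)) (∣-trans (n∣m*n (p zero ^ a zero)) pᵃ∣pᵇ)) i

^ᵛ-injectiveʳ : {p : Fin k → ℕ} → (∀ j → Prime (p j)) → Injective _≡_ _≡_ p →
                (a b : Fin k → ℕ) → p ^ᵛ a ≡ p ^ᵛ b → ∀ i → a i ≡ b i
^ᵛ-injectiveʳ p-prime p-inj a b eq i =
  ≤-antisym (^ᵛ-cancelʳ-∣ p-prime p-inj a b (∣-reflexive eq) i)
            (^ᵛ-cancelʳ-∣ p-prime p-inj b a (∣-reflexive (sym eq)) i)

split-prime-power : ∀ {q m} s d → Prime q → ¬ q ∣ m → d ∣ q ^ s * m →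
                    ∃[ t ] t ≤ s × ∃[ d′ ] d ≡ q ^ t * d′ × d′ ∣ m
split-prime-power {q} {m} s d q-prime q∤m d∣ with q ∣? d
... | no q∤d = 0 , z≤n , d , sym (+-identityʳ d) , ∣^*⇒∣ s q-prime q∤d d∣
split-prime-power {q} {m} zero d q-prime q∤m d∣ | yes (divides d₁ refl) =
  contradiction (∣-trans (n∣m*n d₁) (subst (d₁ * q ∣_) (+-identityʳ m) d∣)) q∤m
split-prime-power {q} {m} (suc s) d q-prime q∤m d∣ | yes (divides d₁ refl)
  with split-prime-power s d₁ q-prime q∤m
         (*-cancelˡ-∣ q {{prime⇒nonZero q-prime}} (subst₂ _∣_ (*-comm d₁ q) (*-assoc q (q ^ s) m) d∣))
... | t , t≤s , d′ , refl , d′∣m =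
  suc t , s≤s t≤s , d′ , trans (*-comm (q ^ t * d′) q) (sym (*-assoc q (q ^ t) d′)) , d′∣m

∣^ᵛ⇒≡^ᵛ : {p : Fin k → ℕ} → (∀ j → Prime (p j)) → Injective _≡_ _≡_ p →
          (b : Fin k → ℕ) (d : ℕ) → d ∣ p ^ᵛ b → ∃[ e ] e ≤ᵛ b × d ≡ p ^ᵛ e
∣^ᵛ⇒≡^ᵛ {zero} p-prime p-inj b d d∣1 = (λ ()) , (λ ()) , ∣1⇒≡1 d∣1
∣^ᵛ⇒≡^ᵛ {suc k} {p} p-prime p-inj b d d∣
  with split-prime-power (b zero) d (p-prime zero) (head∤tail p-prime p-inj (b ∘ suc)) d∣
... | t , t≤ , d′ , refl , d′∣
  with ∣^ᵛ⇒≡^ᵛ (p-prime ∘ suc) (tail-injective p-inj) (b ∘ suc) d′ d′∣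
... | e , e≤ , refl = cons t e , cons-≤ , refl
  where
  cons : ℕ → (Fin k → ℕ) → Fin (suc k) → ℕ
  cons t e zero = t
  cons t e (suc i) = e i
  cons-≤ : cons t e ≤ᵛ b
  cons-≤ zero = t≤
  cons-≤ (suc i) = e≤ i

record ExponentGraph {k} (α : Fin k → ℕ) (V : Set) (_~_ : V → V → Set) : Set where
  field
    exp           : V → Fin k → ℕ
    exp≤α         : ∀ x → exp x ≤ᵛ α
    exp-injective : ∀ {x y} → (∀ i → exp x i ≡ exp y i) → x ≡ y
    exp-nonzero   : ∀ x → ∃[ i ] 0 < exp x i
    exp-nonfull   : ∀ x → ∃[ i ] exp x i < α i
    vertex        : (e : Fin k → ℕ) → e ≤ᵛ α → ∃[ i ] 0 < e i → ∃[ i ] e i < α i → V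
    exp-vertex    : ∀ e e≤α e≢0 e≢α i → exp (vertex e e≤α e≢0 e≢α) i ≡ e i
    ~⇒≢           : ∀ {x y} → x ~ y → x ≢ y
    ~⇒covers      : ∀ {x y} → x ~ y → α ≤ᵛ (λ i → exp x i + exp y i)
    covers⇒~      : ∀ {x y} → x ≢ y → α ≤ᵛ (λ i → exp x i + exp y i) → x ~ y

vertex-≡ : ∀ {n} {x y : Vertex n} → proj₁ x ≡ proj₁ y → x ≡ y
vertex-≡ {x = d , t} {.d , t′} refl = cong (d ,_) (T-irrelevant t t′)

module DivisorExponents {k} {p α : Fin k → ℕ} (p-prime : ∀ j → Prime (p j))
  (p-inj : Injective _≡_ _≡_ p) {n} (n≡p^α : n ≡ p ^ᵛ α) where

  properDivisor : (x : Vertex n) → ProperDivisor n (proj₁ x)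
  properDivisor (_ , t) = toWitness t

  exponents : (x : Vertex n) → ∃[ e ] e ≤ᵛ α × proj₁ x ≡ p ^ᵛ e
  exponents x = ∣^ᵛ⇒≡^ᵛ p-prime p-inj α (proj₁ x)
    (subst (proj₁ x ∣_) n≡p^α (proj₂ (proj₂ (properDivisor x))))

  exp : Vertex n → Fin k → ℕ
  exp x = proj₁ (exponents x)

  ≡p^exp : (x : Vertex n) → proj₁ x ≡ p ^ᵛ exp x
  ≡p^exp x = proj₂ (proj₂ (exponents x))

  ^ᵛ-injective : ∀ a b → p ^ᵛ a ≡ p ^ᵛ b → ∀ i → a i ≡ b i
  ^ᵛ-injective = ^ᵛ-injectiveʳ p-prime p-inj

  exp-injective : ∀ {x y} → (∀ i → exp x i ≡ exp y i) → x ≡ y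
  exp-injective {x} {y} eq = vertex-≡ (trans (≡p^exp x) (trans (^ᵛ-congʳ p eq) (sym (≡p^exp y))))

  *≡^ᵛ+ : ∀ x y → proj₁ x * proj₁ y ≡ p ^ᵛ (λ i → exp x i + exp y i)
  *≡^ᵛ+ x y = trans (cong₂ _*_ (≡p^exp x) (≡p^exp y)) (sym (^ᵛ-distribˡ-+ p (exp x) (exp y)))

  ∣*⇒covers : ∀ x y → n ∣ proj₁ x * proj₁ y → α ≤ᵛ (λ i → exp x i + exp y i)
  ∣*⇒covers x y n∣xy = ^ᵛ-cancelʳ-∣ p-prime p-inj α _ (subst₂ _∣_ n≡p^α (*≡^ᵛ+ x y) n∣xy)

  covers⇒∣* : ∀ x y → α ≤ᵛ (λ i → exp x i + exp y i) → n ∣ proj₁ x * proj₁ y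
  covers⇒∣* x y α≤ = subst₂ _∣_ (sym n≡p^α) (sym (*≡^ᵛ+ x y)) (^ᵛ-monoʳ-∣ p α≤)

  exp-nonzero : ∀ x → ∃[ i ] 0 < exp x i
  exp-nonzero x with any? (λ i → 0 <? exp x i)
  ... | yes nonzero = nonzero
  ... | no zero-everywhere = contradiction x≡1 (>⇒≢ (proj₁ (properDivisor x)))
    where
    x≡1 : proj₁ x ≡ 1
    x≡1 = trans (≡p^exp x) (trans (^ᵛ-congʳ p (λ i → n≤0⇒n≡0 (≮⇒≥ (λ 0<e → zero-everywhere (i , 0<e)))))
                                  (^ᵛ-zeroʳ p))

  exp-nonfull : ∀ x → ∃[ i ] exp x i < α i
  exp-nonfull x with any? (λ i → exp x i <? α i)
  ... | yes nonfull = nonfull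
  ... | no full-everywhere = contradiction x≡n (<⇒≢ (proj₁ (proj₂ (properDivisor x))))
    where
    x≡n : proj₁ x ≡ n
    x≡n = trans (≡p^exp x) (trans (^ᵛ-congʳ p (λ i → ≤-antisym (proj₁ (proj₂ (exponents x)) i)
                                                   (≮⇒≥ (λ e<α → full-everywhere (i , e<α)))))
                                  (sym n≡p^α))

  proper : (e : Fin k → ℕ) → e ≤ᵛ α → ∃[ i ] 0 < e i → ∃[ i ] e i < α i → ProperDivisor n (p ^ᵛ e)
  proper e e≤α (i , 0<eᵢ) (j , eⱼ<αⱼ) = 1<p^e , p^e<n , p^e∣n
    where
    p^e∣n : p ^ᵛ e ∣ n
    p^e∣n = subst (p ^ᵛ e ∣_) (sym n≡p^α) (^ᵛ-monoʳ-∣ p e≤α)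
    1<p^e : 1 < p ^ᵛ e
    1<p^e = ≤∧≢⇒< (^ᵛ-positive p-prime e)
      (λ 1≡p^e → >⇒≢ 0<eᵢ (^ᵛ-injective e (λ _ → 0) (trans (sym 1≡p^e) (sym (^ᵛ-zeroʳ p))) i))
    p^e<n : p ^ᵛ e < n
    p^e<n = ≤∧≢⇒< (∣⇒≤ {{>-nonZero (subst (0 <_) (sym n≡p^α) (^ᵛ-positive p-prime α))}} p^e∣n)
      (λ p^e≡n → <⇒≢ eⱼ<αⱼ (^ᵛ-injective e α (trans p^e≡n n≡p^α) j))

  exponentGraph : ExponentGraph α (Vertex n) (Adj n)
  exponentGraph = record
    { exp           = exp
    ; exp≤α         = λ x → proj₁ (proj₂ (exponents x))
    ; exp-injective = exp-injective
    ; exp-nonzero   = exp-nonzero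
    ; exp-nonfull   = exp-nonfull
    ; vertex        = λ e e≤α e≢0 e≢α → p ^ᵛ e , fromWitness (proper e e≤α e≢0 e≢α)
    ; exp-vertex    = λ e e≤α e≢0 e≢α → ^ᵛ-injective _ e (sym (≡p^exp (p ^ᵛ e , _)))
    ; ~⇒≢           = λ x~y x≡y → proj₁ x~y (cong proj₁ x≡y)
    ; ~⇒covers      = λ {x} {y} x~y → ∣*⇒covers x y (proj₂ x~y)
    ; covers⇒~      = λ {x} {y} x≢y α≤ → (λ eq → x≢y (vertex-≡ eq)) , covers⇒∣* x y α≤
    }

no-three-in-two : ∀ {A : Set} {a b x y z : A} → x ≡ a ⊎ x ≡ b → y ≡ a ⊎ y ≡ b → z ≡ a ⊎ z ≡ b →
                  x ≢ y → x ≢ z → y ≢ z → ⊥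
no-three-in-two (inj₁ refl) (inj₁ refl) _ x≢y _ _ = x≢y refl
no-three-in-two (inj₂ refl) (inj₂ refl) _ x≢y _ _ = x≢y refl
no-three-in-two (inj₁ refl) (inj₂ refl) (inj₁ refl) _ x≢z _ = x≢z refl
no-three-in-two (inj₁ refl) (inj₂ refl) (inj₂ refl) _ _ y≢z = y≢z refl
no-three-in-two (inj₂ refl) (inj₁ refl) (inj₁ refl) _ _ y≢z = y≢z refl
no-three-in-two (inj₂ refl) (inj₁ refl) (inj₂ refl) _ x≢z _ = x≢z refl

updateAt-elim : ∀ {k} (P : Fin k → ℕ → Set) {xs : Fin k → ℕ} {i f} l →
                P i (f (xs i)) → (l ≢ i → P l (xs l)) → P l (updateAt xs i f l)
updateAt-elim P {xs} {i} l at-i elsewhere with l ≟ᶠ i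
... | yes refl = subst (P l) (sym (updateAt-updates l xs)) at-i
... | no l≢i = subst (P l) (sym (updateAt-minimal l i xs l≢i)) (elsewhere l≢i)

module Rigidity {k} {α : Fin k → ℕ} {V : Set} {_~_ : V → V → Set} (G : ExponentGraph α V _~_)
  (other : Fin k → Fin k) (other≢ : ∀ i → other i ≢ i) (α-positive : ∀ i → 0 < α i)
  (not-p²q : ∀ i j → i ≢ j → (∀ l → l ≡ i ⊎ l ≡ j) → α i ≡ 2 → α j ≡ 1 → ⊥) where

  open ExponentGraph G

  _≐_ : V → (Fin k → ℕ) → Set
  x ≐ e = ∀ i → exp x i ≡ e i

  ≐-unique : ∀ {x y e} → x ≐ e → y ≐ e → x ≡ y
  ≐-unique x≐e y≐e = exp-injective (λ i → trans (x≐e i) (sym (y≐e i)))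

  ≐-distinct : ∀ {x y e f} i → x ≐ e → y ≐ f → e i ≢ f i → x ≢ y
  ≐-distinct i x≐e y≐f eᵢ≢fᵢ refl = eᵢ≢fᵢ (trans (sym (x≐e i)) (y≐f i))

  _≟ᵥ_ : (x y : V) → Dec (x ≡ y)
  x ≟ᵥ y = map′ exp-injective (λ x≡y i → cong (λ z → exp z i) x≡y) (all? (λ i → exp x i ≟ exp y i))

  -- opaque: a vertex built from an exponent vector is only ever used through that vector
  opaque
    vertexWith : (e : Fin k → ℕ) → e ≤ᵛ α → ∃[ i ] 0 < e i → ∃[ i ] e i < α i → Σ V (_≐ e)
    vertexWith e e≤α e≢0 e≢α = vertex e e≤α e≢0 e≢α , exp-vertex e e≤α e≢0 e≢α

  -- the exponent vectors of p_i ^ t and of n / p_i ^ s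
  pow : Fin k → ℕ → Fin k → ℕ
  pow i t = updateAt (λ _ → 0) i (λ _ → t)

  copow : Fin k → ℕ → Fin k → ℕ
  copow i s = updateAt α i (_∸ s)

  pow-self : ∀ i {t} → pow i t i ≡ t
  pow-self i = updateAt-updates i _

  pow-other : ∀ {i t l} → l ≢ i → pow i t l ≡ 0
  pow-other {i} {l = l} = updateAt-minimal l i _

  copow-self : ∀ i {s} → copow i s i ≡ α i ∸ s
  copow-self i = updateAt-updates i α

  copow-other : ∀ {i s l} → l ≢ i → copow i s l ≡ α l
  copow-other {i} {l = l} = updateAt-minimal l i α

  pow-vertex : ∀ i {t} → 0 < t → t ≤ α i → Σ V (_≐ pow i t)
  pow-vertex i {t} 0<t t≤α = vertexWith (pow i t)
    (λ l → updateAt-elim (λ l v → v ≤ α l) l t≤α (λ _ → z≤n))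
    (i , subst (0 <_) (sym (pow-self i {t})) 0<t)
    (other i , subst (_< α (other i)) (sym (pow-other {i} {t} (other≢ i))) (α-positive (other i)))

  copow-vertex : ∀ i {s} → 0 < s → s ≤ α i → Σ V (_≐ copow i s)
  copow-vertex i {s} 0<s s≤α = vertexWith (copow i s)
    (λ l → updateAt-elim (λ l v → v ≤ α l) l (m∸n≤m (α i) s) (λ _ → ≤-refl))
    (other i , subst (0 <_) (sym (copow-other {i} {s} (other≢ i))) (α-positive (other i)))
    (i , subst (_< α i) (sym (copow-self i {s})) (∸-monoʳ-< 0<s s≤α))

  copow-injective : ∀ {i s s′ c} → c ≐ copow i s → c ≐ copow i s′ → s ≤ α i → s′ ≤ α i → s ≡ s′
  copow-injective {i} {s} {s′} c≐s c≐s′ s≤α s′≤α = ∸-cancelˡ-≡ s≤α s′≤α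
    (trans (sym (trans (c≐s i) (copow-self i {s}))) (trans (c≐s′ i) (copow-self i {s′})))

  pow1-injective : ∀ {i j x} → x ≐ pow i 1 → x ≐ pow j 1 → i ≡ j
  pow1-injective {i} {j} x≐i x≐j with i ≟ᶠ j
  ... | yes i≡j = i≡j
  ... | no i≢j = contradiction (trans (sym (trans (x≐i i) (pow-self i))) (trans (x≐j i) (pow-other i≢j)))
                               λ ()

  complement : V → Fin k → ℕ
  complement x l = α l ∸ exp x l

  ≥complement⇒~ : ∀ {x z} → x ≢ z → complement x ≤ᵛ exp z → x ~ z
  ≥complement⇒~ {x} x≢z z≥ =
    covers⇒~ x≢z (λ l → ≤-trans (m≤n+m∸n (α l) (exp x l)) (+-monoʳ-≤ (exp x l) (z≥ l)))

  ~⇒≥complement : ∀ {x z} → x ~ z → complement x ≤ᵛ exp z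
  ~⇒≥complement {x} x~z l = m≤n+o⇒m∸n≤o (α l) (exp x l) (~⇒covers x~z l)

  ~-sym : ∀ {x z} → x ~ z → z ~ x
  ~-sym {x} {z} x~z = covers⇒~ (~⇒≢ x~z ∘ sym) (λ l → subst (α l ≤_) (+-comm (exp x l) (exp z l)) (~⇒covers x~z l))

  pow-neighbour : ∀ {i m x z} → x ≐ pow i m → x ~ z → ∃[ s ] 0 < s × s ≤ m × z ≐ copow i s
  pow-neighbour {i} {m} {x} {z} x≐ x~z = α i ∸ exp z i , m<n⇒0<n∸m zᵢ<αᵢ , s≤m , z≐
    where
    full-elsewhere : ∀ {l} → l ≢ i → exp z l ≡ α l
    full-elsewhere {l} l≢i = ≤-antisym (exp≤α z l)
      (subst (λ e → α l ∸ e ≤ exp z l) (trans (x≐ l) (pow-other l≢i)) (~⇒≥complement x~z l))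
    zᵢ<αᵢ : exp z i < α i
    zᵢ<αᵢ with exp-nonfull z
    ... | l , zₗ<αₗ with l ≟ᶠ i
    ...   | yes refl = zₗ<αₗ
    ...   | no l≢i = contradiction (full-elsewhere l≢i) (<⇒≢ zₗ<αₗ)
    s≤m : α i ∸ exp z i ≤ m
    s≤m = m≤n+o⇒m∸n≤o (α i) (exp z i) (subst (α i ≤_) (+-comm m (exp z i))
      (subst (λ e → α i ≤ e + exp z i) (trans (x≐ i) (pow-self i)) (~⇒covers x~z i)))
    z≐ : z ≐ copow i (α i ∸ exp z i)
    z≐ l = sym (updateAt-elim (λ l v → v ≡ exp z l) l (m∸[m∸n]≡n (exp≤α z i)) (sym ∘ full-elsewhere))

  pow~copow : ∀ {i m s x c} → x ≐ pow i m → c ≐ copow i s → s ≤ m → x ~ c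
  pow~copow {i} {m} {s} {x} {c} x≐ c≐ s≤m = ≥complement⇒~ x≢c c≥
    where
    x≢c : x ≢ c
    x≢c = ≐-distinct (other i) x≐ c≐ λ eq →
      <⇒≢ (α-positive (other i))
          (trans (sym (pow-other {i} {m} (other≢ i))) (trans eq (copow-other {i} {s} (other≢ i))))
    c≥ : complement x ≤ᵛ exp c
    c≥ l = subst₂ (λ e f → α l ∸ e ≤ f) (sym (x≐ l)) (sym (c≐ l))
      (updateAt-elim (λ l v → α l ∸ pow i m l ≤ v) l
        (subst (λ e → α i ∸ e ≤ α i ∸ s) (sym (pow-self i)) (∸-monoʳ-≤ (α i) s≤m))
        (λ l≢i → subst (λ e → α l ∸ e ≤ α l) (sym (pow-other l≢i)) ≤-refl))

  ≤exp⇒~copow⊎≡ : ∀ {i s x c} → c ≐ copow i s → s ≤ exp x i → x ~ c ⊎ x ≡ c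
  ≤exp⇒~copow⊎≡ {i} {s} {x} {c} c≐ s≤xᵢ with x ≟ᵥ c
  ... | yes x≡c = inj₂ x≡c
  ... | no x≢c = inj₁ (≥complement⇒~ x≢c λ l → subst (complement x l ≤_) (sym (c≐ l))
          (updateAt-elim (λ l v → α l ∸ exp x l ≤ v) l (∸-monoʳ-≤ (α i) s≤xᵢ) (λ _ → m∸n≤m (α l) (exp x l))))

  ~copow⇒≤exp : ∀ {i s x c} → c ≐ copow i s → s ≤ α i → x ~ c → s ≤ exp x i
  ~copow⇒≤exp {i} {s} {x} c≐ s≤α x~c = subst (_≤ exp x i)
    (trans (cong (α i ∸_) (trans (c≐ i) (copow-self i {s}))) (m∸[m∸n]≡n s≤α))
    (~⇒≥complement (~-sym x~c) i)

  Leaf : V → Set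
  Leaf x = ∃[ y ] x ~ y × (∀ z → x ~ z → z ≡ y)

  pow1-leaf : ∀ {i x} → x ≐ pow i 1 → Leaf x
  pow1-leaf {i} {x} x≐ = proj₁ c , pow~copow x≐ (proj₂ c) ≤-refl , unique
    where
    c = copow-vertex i ≤-refl (α-positive i)
    unique : ∀ z → x ~ z → z ≡ proj₁ c
    unique z x~z with pow-neighbour x≐ x~z
    ... | s , 0<s , s≤1 , z≐ = ≐-unique (subst (λ s → z ≐ copow i s) (≤-antisym s≤1 0<s) z≐) (proj₂ c)

  raise : Fin k → (Fin k → ℕ) → Fin k → ℕ
  raise j e = updateAt e j suc

  module _ {x : V} where

    complement-vertex : Σ V (_≐ complement x)
    complement-vertex = vertexWith (complement x) (λ l → m∸n≤m (α l) (exp x l))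
      (let l , xₗ<αₗ = exp-nonfull x in l , m<n⇒0<n∸m xₗ<αₗ)
      (let l , 0<xₗ = exp-nonzero x in l , ∸-monoʳ-< 0<xₗ (exp≤α x l))

    raised-complement-vertex : ∀ {j} → 0 < exp x j → ∀ w → raise j (complement x) w < α w →
                               Σ V (_≐ raise j (complement x))
    raised-complement-vertex {j} 0<xⱼ w raised<α = vertexWith (raise j (complement x))
      (λ l → updateAt-elim (λ l v → v ≤ α l) l (∸-monoʳ-< 0<xⱼ (exp≤α x j)) (λ _ → m∸n≤m (α l) (exp x l)))
      (j , subst (0 <_) (sym (updateAt-updates j (complement x))) (s≤s z≤n))
      (w , raised<α)

    raise-other< : ∀ {i j} → i ≢ j → 0 < exp x i → raise j (complement x) i < α i
    raise-other< {i} {j} i≢j 0<xᵢ =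
      subst (_< α i) (sym (updateAt-minimal i j _ i≢j)) (∸-monoʳ-< 0<xᵢ (exp≤α x i))

    ≥complement : ∀ {z} → z ≐ complement x → complement x ≤ᵛ exp z
    ≥complement z≐ l = ≤-reflexive (sym (z≐ l))

    ≥raised : ∀ {j z} → z ≐ raise j (complement x) → complement x ≤ᵛ exp z
    ≥raised {j} z≐ l = subst (complement x l ≤_) (sym (z≐ l))
      (updateAt-elim (λ l v → complement x l ≤ v) l (n≤1+n _) (λ _ → ≤-refl))

    raised-distinct : ∀ {j z z′} → z ≐ complement x → z′ ≐ raise j (complement x) → z ≢ z′
    raised-distinct {j} z≐ z′≐ = ≐-distinct j z≐ z′≐ λ eq →
      1+n≢n (sym (trans eq (updateAt-updates j (complement x))))

    raised-distinct₂ : ∀ {i j z z′} → i ≢ j → z ≐ raise i (complement x) → z′ ≐ raise j (complement x) →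
                       z ≢ z′
    raised-distinct₂ {i} {j} i≢j z≐ z′≐ = ≐-distinct i z≐ z′≐ λ eq →
      1+n≢n (trans (sym (updateAt-updates i (complement x))) (trans eq (updateAt-minimal i j _ i≢j)))

  module _ {x : V} (leaf : Leaf x) where

    leaf-neighbour : ∀ {z} → complement x ≤ᵛ exp z → z ≢ x → z ≡ proj₁ leaf
    leaf-neighbour z≥ z≢x = proj₂ (proj₂ leaf) _ (≥complement⇒~ (z≢x ∘ sym) z≥)

    leaf-above : ∀ {z} → complement x ≤ᵛ exp z → z ≡ x ⊎ z ≡ proj₁ leaf
    leaf-above {z} z≥ with z ≟ᵥ x
    ... | yes z≡x = inj₁ z≡x
    ... | no z≢x = inj₂ (leaf-neighbour z≥ z≢x)

    leaf-support : ∀ {i j} → 0 < exp x i → 0 < exp x j → i ≡ j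
    leaf-support {i} {j} 0<xᵢ 0<xⱼ with i ≟ᶠ j
    ... | yes i≡j = i≡j
    ... | no i≢j = ⊥-elim (no-three-in-two (leaf-above (≥complement (proj₂ z₀)))
          (leaf-above (≥raised (proj₂ zᵢ))) (leaf-above (≥raised (proj₂ zⱼ)))
          (raised-distinct (proj₂ z₀) (proj₂ zᵢ)) (raised-distinct (proj₂ z₀) (proj₂ zⱼ))
          (raised-distinct₂ i≢j (proj₂ zᵢ) (proj₂ zⱼ)))
      where
      z₀ = complement-vertex
      zᵢ = raised-complement-vertex 0<xᵢ j (raise-other< (i≢j ∘ sym) 0<xⱼ)
      zⱼ = raised-complement-vertex 0<xⱼ i (raise-other< i≢j 0<xᵢ)

    leaf-zero-elsewhere : ∀ {i l} → 0 < exp x i → l ≢ i → exp x l ≡ 0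
    leaf-zero-elsewhere 0<xᵢ l≢i = n≤0⇒n≡0 (≮⇒≥ (λ 0<xₗ → l≢i (leaf-support 0<xₗ 0<xᵢ)))

    leaf-exp≤1 : ∀ {i} → 0 < exp x i → exp x i ≤ 1
    leaf-exp≤1 {i} 0<xᵢ with 2 ≤? exp x i
    ... | no xᵢ≱2 = ≤-pred (≰⇒> xᵢ≱2)
    ... | yes 2≤xᵢ = contradiction
          (trans (leaf-neighbour (≥complement (proj₂ z₀)) (≢x (proj₂ z₀) refl))
                 (sym (leaf-neighbour (≥raised (proj₂ z₁)) (≢x (proj₂ z₁) (updateAt-minimal o i _ (other≢ i))))))
          (raised-distinct (proj₂ z₀) (proj₂ z₁))
      where
      o = other i
      xₒ≡0 : exp x o ≡ 0
      xₒ≡0 = leaf-zero-elsewhere 0<xᵢ (other≢ i)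
      ≢x : ∀ {z f} → z ≐ f → f o ≡ complement x o → z ≢ x
      ≢x z≐ fₒ refl = <⇒≢ (α-positive o) (trans (sym xₒ≡0) (trans (z≐ o) (trans fₒ (cong (α o ∸_) xₒ≡0))))
      raised<α : suc (complement x i) < α i
      raised<α = subst (_≤ α i) (+-comm (complement x i) 2)
        (subst (complement x i + 2 ≤_) (m∸n+n≡m (exp≤α x i)) (+-monoʳ-≤ (complement x i) 2≤xᵢ))
      z₀ = complement-vertex
      z₁ = raised-complement-vertex 0<xᵢ i (subst (_< α i) (sym (updateAt-updates i (complement x))) raised<α)

  leaf⇒pow1 : ∀ {x} → Leaf x → ∃[ i ] x ≐ pow i 1
  leaf⇒pow1 {x} leaf with exp-nonzero x
  ... | i , 0<xᵢ = i , λ l → updateAt-elim (λ l v → exp x l ≡ v) l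
                               (≤-antisym (leaf-exp≤1 leaf 0<xᵢ) 0<xᵢ) (leaf-zero-elsewhere leaf 0<xᵢ)

  record Automorphism : Set where
    field
      to from : V → V
      to-from : ∀ v → to (from v) ≡ v
      from-to : ∀ v → from (to v) ≡ v
      to-~    : ∀ {u v} → u ~ v → to u ~ to v
      to-~⁻¹  : ∀ {u v} → to u ~ to v → u ~ v

  _⁻¹ : Automorphism → Automorphism
  σ ⁻¹ = record
    { to = from ; from = to ; to-from = from-to ; from-to = to-from
    ; to-~ = λ {u} {v} u~v → to-~⁻¹ (subst₂ _~_ (sym (to-from u)) (sym (to-from v)) u~v)
    ; to-~⁻¹ = λ {u} {v} fu~fv → subst₂ _~_ (to-from u) (to-from v) (to-~ fu~fv)
    }
    where open Automorphism σ

  pow1 : ∀ i → Σ V (_≐ pow i 1)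
  pow1 i = pow-vertex i ≤-refl (α-positive i)

  module Induced (σ : Automorphism) where
    open Automorphism σ

    ~-from : ∀ {a b} → to a ~ b → a ~ from b
    ~-from {a} {b} σa~b = to-~⁻¹ (subst (to a ~_) (sym (to-from b)) σa~b)

    leaf-preserved : ∀ {x} → Leaf x → Leaf (to x)
    leaf-preserved (y , x~y , unique) = to y , to-~ x~y , λ z σx~z →
      trans (sym (to-from z)) (cong to (unique (from z) (~-from σx~z)))

    σ-leaf : ∀ i → ∃[ j ] to (proj₁ (pow1 i)) ≐ pow j 1
    σ-leaf i = leaf⇒pow1 (leaf-preserved (pow1-leaf (proj₂ (pow1 i))))

    π : Fin k → Fin k
    π i = proj₁ (σ-leaf i)

    σ-pow1 : ∀ {i x} → x ≐ pow i 1 → to x ≐ pow (π i) 1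
    σ-pow1 {i} x≐ = subst (λ z → to z ≐ pow (π i) 1) (≐-unique (proj₂ (pow1 i)) x≐) (proj₂ (σ-leaf i))

    σ-copow1 : ∀ {i x} → x ≐ copow i 1 → to x ≐ copow (π i) 1
    σ-copow1 {i} {x} x≐ with pow-neighbour (σ-pow1 (proj₂ (pow1 i))) (to-~ (pow~copow (proj₂ (pow1 i)) x≐ ≤-refl))
    ... | s , 0<s , s≤1 , σx≐ = subst (λ s → to x ≐ copow (π i) s) (≤-antisym s≤1 0<s) σx≐

  module Permuted (σ : Automorphism) where
    open Automorphism σ
    open Induced σ public
    open Induced (σ ⁻¹) public using () renaming (π to π⁻¹; σ-pow1 to σ⁻¹-pow1; σ-copow1 to σ⁻¹-copow1)

    π-π⁻¹ : ∀ j → π (π⁻¹ j) ≡ j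
    π-π⁻¹ j = pow1-injective
      (subst (_≐ pow (π (π⁻¹ j)) 1) (to-from _) (σ-pow1 (σ⁻¹-pow1 (proj₂ (pow1 j))))) (proj₂ (pow1 j))

    π⁻¹-π : ∀ i → π⁻¹ (π i) ≡ i
    π⁻¹-π i = pow1-injective
      (subst (_≐ pow (π⁻¹ (π i)) 1) (from-to _) (σ⁻¹-pow1 (σ-pow1 (proj₂ (pow1 i))))) (proj₂ (pow1 i))

    π-injective : ∀ {i j} → π i ≡ π j → i ≡ j
    π-injective {i} {j} πi≡πj = trans (sym (π⁻¹-π i)) (trans (cong π⁻¹ πi≡πj) (π⁻¹-π j))

  module CopowersPreserved (σ : Automorphism) where
    open Automorphism σ
    open Permuted σ

    Preserves : ℕ → Fin k → Set
    Preserves s i = s ≤ α (π i) × (∀ {x} → x ≐ copow i s → to x ≐ copow (π i) s)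

    Below : ℕ → Set
    Below t = ∀ {s i} → 0 < s → s ≤ t → s ≤ α i → Preserves s i

    σ-pow : ∀ {i T v} → v ≐ pow i T → (∀ {j} → j ≢ i → ¬ v ≐ copow j 1) →
            to v ≐ pow (π i) (exp (to v) (π i))
    σ-pow {i} {v = v} v≐ v≢copow l = updateAt-elim (λ l e → exp (to v) l ≡ e) l refl zero-elsewhere
      where
      zero-elsewhere : ∀ {l} → l ≢ π i → exp (to v) l ≡ 0
      zero-elsewhere {l} l≢πi = n≤0⇒n≡0 (≮⇒≥ λ 0<σvₗ → [ adjacent , equal ]′ (≤exp⇒~copow⊎≡ (proj₂ c) 0<σvₗ))
        where
        c = copow-vertex l ≤-refl (α-positive l)
        from-c≐ : from (proj₁ c) ≐ copow (π⁻¹ l) 1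
        from-c≐ = σ⁻¹-copow1 (proj₂ c)
        π⁻¹l≢i : π⁻¹ l ≢ i
        π⁻¹l≢i π⁻¹l≡i = l≢πi (trans (sym (π-π⁻¹ l)) (cong π π⁻¹l≡i))
        adjacent : to v ~ proj₁ c → ⊥
        adjacent σv~c = contradiction (trans (v≐ (π⁻¹ l)) (pow-other π⁻¹l≢i))
          (>⇒≢ (~copow⇒≤exp from-c≐ (α-positive (π⁻¹ l)) (~-from σv~c)))
        equal : to v ≡ proj₁ c → ⊥
        equal σv≡c = v≢copow π⁻¹l≢i (subst (_≐ copow (π⁻¹ l) 1) (trans (cong from (sym σv≡c)) (from-to v)) from-c≐)

    module Step {t} (below : Below (suc t)) {i} (T≤α : suc (suc t) ≤ α i) where

      v : Σ V (_≐ pow i (suc (suc t)))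
      v = pow-vertex i (s≤s z≤n) T≤α

      w : Σ V (_≐ copow i (suc (suc t)))
      w = copow-vertex i (s≤s z≤n) T≤α

      σ-copow-below : ∀ {s z} → 0 < s → s ≤ suc t → from z ≐ copow i s → z ≐ copow (π i) s
      σ-copow-below {z = z} 0<s s≤ from-z≐ = subst (_≐ _) (to-from z)
        (proj₂ (below 0<s s≤ (≤-trans s≤ (≤-trans (n≤1+n _) T≤α))) from-z≐)

      neighbour-of-σv : ∀ {z} → to (proj₁ v) ~ z → (∃[ s ] s ≤ suc t × z ≐ copow (π i) s) ⊎ from z ≡ proj₁ w
      neighbour-of-σv σv~z with pow-neighbour (proj₂ v) (~-from σv~z)
      ... | s , 0<s , s≤T , from-z≐ with s ≤? suc t
      ...   | yes s≤t = inj₁ (s , s≤t , σ-copow-below 0<s s≤t from-z≐)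
      ...   | no s≰t = inj₂ (≐-unique (subst (λ s → _ ≐ copow i s) (≤-antisym s≤T (≰⇒> s≰t)) from-z≐) (proj₂ w))

      -- σ v is a power of p_{π i}; the images of the neighbours n / p_i ^ s (s ≤ t + 1) of v
      -- are its neighbours n / p_{π i} ^ s, so σ w can only be n / p_{π i} ^ (t + 2).
      module NotCopow (v≢copow : ∀ {j} → j ≢ i → ¬ proj₁ v ≐ copow j 1) where

        m : ℕ
        m = exp (to (proj₁ v)) (π i)

        σv≐ : to (proj₁ v) ≐ pow (π i) m
        σv≐ = σ-pow (proj₂ v) v≢copow

        pulls-back-to-w : ∀ {s z} → z ≐ copow (π i) s → suc t < s → s ≤ α (π i) → to (proj₁ v) ~ z →
                          from z ≡ proj₁ w
        pulls-back-to-w z≐ t<s s≤α σv~z with neighbour-of-σv σv~z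
        ... | inj₂ from-z≡w = from-z≡w
        ... | inj₁ (s′ , s′≤t , z≐′) = contradiction
                (copow-injective z≐ z≐′ s≤α (≤-trans s′≤t (≤-trans (n≤1+n _) (≤-trans t<s s≤α))))
                (λ s≡s′ → <⇒≱ t<s (subst (_≤ suc t) (sym s≡s′) s′≤t))

        m≤T : m ≤ suc (suc t)
        m≤T with m ≤? suc (suc t)
        ... | yes m≤T = m≤T
        ... | no m≰T = contradiction (copow-injective (proj₂ c₂)
                         (subst (_≐ copow (π i) (suc (suc t))) c₁≡c₂ (proj₂ c₁)) T+1≤α T≤α′) 1+n≢n
          where
          T+1≤α : suc (suc (suc t)) ≤ α (π i)
          T+1≤α = ≤-trans (≰⇒> m≰T) (exp≤α _ (π i))
          T≤α′ : suc (suc t) ≤ α (π i)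
          T≤α′ = ≤-trans (n≤1+n _) T+1≤α
          c₁ : Σ V (_≐ copow (π i) (suc (suc t)))
          c₁ = copow-vertex (π i) (s≤s z≤n) T≤α′
          c₂ : Σ V (_≐ copow (π i) (suc (suc (suc t))))
          c₂ = copow-vertex (π i) (s≤s z≤n) T+1≤α
          c₁≡c₂ : proj₁ c₁ ≡ proj₁ c₂
          c₁≡c₂ = trans (sym (to-from _)) (trans (cong to (trans
            (pulls-back-to-w (proj₂ c₁) ≤-refl T≤α′ (pow~copow σv≐ (proj₂ c₁) (≤-trans (n≤1+n _) (≰⇒> m≰T))))
            (sym (pulls-back-to-w (proj₂ c₂) (n≤1+n _) T+1≤α (pow~copow σv≐ (proj₂ c₂) (≰⇒> m≰T))))))
            (to-from _))

        σw-neighbour : ∃[ s ] 0 < s × s ≤ m × to (proj₁ w) ≐ copow (π i) s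
        σw-neighbour = pow-neighbour σv≐ (to-~ (pow~copow (proj₂ v) (proj₂ w) ≤-refl))

        beyond-below : ∀ {s} → 0 < s → to (proj₁ w) ≐ copow (π i) s → suc t < s
        beyond-below {s} 0<s σw≐ with s ≤? suc t
        ... | no s≰t = ≰⇒> s≰t
        ... | yes s≤t = contradiction (copow-injective (subst (_≐ copow i s) c≡w (proj₂ c)) (proj₂ w) s≤α T≤α)
                                      (λ s≡T → 1+n≰n (subst (_≤ suc t) s≡T s≤t))
          where
          s≤α : s ≤ α i
          s≤α = ≤-trans s≤t (≤-trans (n≤1+n _) T≤α)
          c : Σ V (_≐ copow i s)
          c = copow-vertex i 0<s s≤α
          c≡w : proj₁ c ≡ proj₁ w
          c≡w = trans (sym (from-to _))
            (trans (cong from (≐-unique (proj₂ (below 0<s s≤t s≤α) (proj₂ c)) σw≐)) (from-to _))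

        preserves : Preserves (suc (suc t)) i
        preserves = ≤-trans t<s (≤-trans s≤m (exp≤α _ (π i))) , σ-copow
          where
          s = proj₁ σw-neighbour
          s≤m = proj₁ (proj₂ (proj₂ σw-neighbour))
          σw≐ = proj₂ (proj₂ (proj₂ σw-neighbour))
          t<s : suc t < s
          t<s = beyond-below (proj₁ (proj₂ σw-neighbour)) σw≐
          σ-copow : ∀ {x} → x ≐ copow i (suc (suc t)) → to x ≐ copow (π i) (suc (suc t))
          σ-copow x≐ = subst₂ (λ x s → to x ≐ copow (π i) s) (≐-unique (proj₂ w) x≐)
                              (≤-antisym (≤-trans s≤m m≤T) t<s) σw≐

      -- Here n = p_i ^ (t + 2) p_j and w = p_j: either π fixes i and j, or π swaps them, which
      -- forces t + 1 ≤ α j = 1, that is n = p_i² p_j.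
      module Copow {j} (j≢i : j ≢ i) (v≐copow : proj₁ v ≐ copow j 1) where

        v-off : ∀ {l} → l ≢ i → exp (proj₁ v) l ≡ 0
        v-off l≢i = trans (proj₂ v _) (pow-other {i} {suc (suc t)} l≢i)

        cover : ∀ l → l ≡ i ⊎ l ≡ j
        cover l with l ≟ᶠ i | l ≟ᶠ j
        ... | yes l≡i | _ = inj₁ l≡i
        ... | no _ | yes l≡j = inj₂ l≡j
        ... | no l≢i | no l≢j = contradiction
                (trans (sym (v-off l≢i)) (trans (v≐copow l) (copow-other {j} {1} l≢j))) (<⇒≢ (α-positive l))

        αⱼ≡1 : α j ≡ 1
        αⱼ≡1 = ≤-antisym (m∸n≡0⇒m≤n (trans (sym (copow-self j {1})) (trans (sym (v≐copow j)) (v-off j≢i))))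
                         (α-positive j)

        αᵢ≡T : α i ≡ suc (suc t)
        αᵢ≡T = trans (sym (copow-other {j} {1} (j≢i ∘ sym)))
                     (trans (sym (v≐copow i)) (trans (proj₂ v i) (pow-self i {suc (suc t)})))

        copow≗pow : ∀ l → copow i (suc (suc t)) l ≡ pow j 1 l
        copow≗pow l with cover l
        ... | inj₁ refl = trans (copow-self l {suc (suc t)}) (trans (cong (_∸ suc (suc t)) αᵢ≡T)
                            (trans (n∸n≡0 (suc (suc t))) (sym (pow-other {j} {1} (j≢i ∘ sym)))))
        ... | inj₂ refl = trans (copow-other {i} {suc (suc t)} j≢i) (trans αⱼ≡1 (sym (pow-self l {1})))

        preserves : Preserves (suc (suc t)) i
        preserves with π i ≟ᶠ i
        ... | yes πi≡i = subst (λ l → suc (suc t) ≤ α l) (sym πi≡i) T≤α , σ-copow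
          where
          πj≡j : π j ≡ j
          πj≡j = [ (λ πj≡i → contradiction (π-injective (trans πj≡i (sym πi≡i))) j≢i) , id ]′ (cover (π j))
          σ-copow : ∀ {x} → x ≐ copow i (suc (suc t)) → to x ≐ copow (π i) (suc (suc t))
          σ-copow x≐ l = trans (subst (λ j′ → to _ ≐ pow j′ 1) πj≡j (σ-pow1 (λ l → trans (x≐ l) (copow≗pow l))) l)
                               (trans (sym (copow≗pow l)) (cong (λ i′ → copow i′ (suc (suc t)) l) (sym πi≡i)))
        ... | no πi≢i = ⊥-elim (not-p²q i j (j≢i ∘ sym) cover αᵢ≡2 αⱼ≡1)
          where
          πi≡j : π i ≡ j
          πi≡j = [ (λ πi≡i → contradiction πi≡i πi≢i) , id ]′ (cover (π i))
          t≡0 : t ≡ 0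
          t≡0 = n≤0⇒n≡0 (≤-pred (subst (suc t ≤_) (trans (cong α πi≡j) αⱼ≡1)
                  (proj₁ (below (s≤s z≤n) ≤-refl (≤-trans (n≤1+n _) T≤α)))))
          αᵢ≡2 : α i ≡ 2
          αᵢ≡2 = trans αᵢ≡T (cong (λ t → suc (suc t)) t≡0)

      preserves : Preserves (suc (suc t)) i
      preserves with any? (λ j → ¬? (j ≟ᶠ i) ×-dec all? (λ l → exp (proj₁ v) l ≟ copow j 1 l))
      ... | yes (j , j≢i , v≐) = Copow.preserves j≢i v≐
      ... | no ¬copow = NotCopow.preserves (λ j≢i v≐ → ¬copow (_ , j≢i , v≐))

    preserves-suc : ∀ t → Below t → ∀ {i} → suc t ≤ α i → Preserves (suc t) i
    preserves-suc zero _ {i} _ = α-positive (π i) , σ-copow1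
    preserves-suc (suc t) below T≤α = Step.preserves below T≤α

    below : ∀ t → Below t
    below zero 0<s s≤0 _ = contradiction (≤-trans 0<s s≤0) λ ()
    below (suc t) {s} 0<s s≤ s≤α with s ≤? t
    ... | yes s≤t = below t 0<s s≤t s≤α
    ... | no s≰t with ≤-antisym s≤ (≰⇒> s≰t)
    ...   | refl = preserves-suc t (below t) s≤α

    σ-copow : ∀ {i s x} → 0 < s → s ≤ α i → x ≐ copow i s → to x ≐ copow (π i) s
    σ-copow {s = s} 0<s s≤α = proj₂ (below s 0<s ≤-refl s≤α)

    α≤α∘π : ∀ i → α i ≤ α (π i)
    α≤α∘π i = proj₁ (below (α i) (α-positive i) ≤-refl ≤-refl)

  module Coordinates (σ : Automorphism) where
    open Automorphism σ
    open Permuted σ public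
    open CopowersPreserved σ public
    open CopowersPreserved (σ ⁻¹) using () renaming (α≤α∘π to α≤α∘π⁻¹)

    α∘π : ∀ i → α (π i) ≡ α i
    α∘π i = ≤-antisym (subst (λ j → α (π i) ≤ α j) (π⁻¹-π i) (α≤α∘π⁻¹ (π i))) (α≤α∘π i)

    ≤exp⇒≤exp∘σ : ∀ {x i s} → 0 < s → s ≤ exp x i → s ≤ exp (to x) (π i)
    ≤exp⇒≤exp∘σ {x} {i} {s} 0<s s≤xᵢ = [ adjacent , equal ]′ (≤exp⇒~copow⊎≡ (proj₂ c) s≤xᵢ)
      where
      s≤α = ≤-trans s≤xᵢ (exp≤α x i)
      c = copow-vertex i 0<s s≤α
      adjacent : x ~ proj₁ c → s ≤ exp (to x) (π i)
      adjacent x~c = ~copow⇒≤exp (σ-copow 0<s s≤α (proj₂ c)) (subst (s ≤_) (sym (α∘π i)) s≤α) (to-~ x~c)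
      equal : x ≡ proj₁ c → s ≤ exp (to x) (π i)
      equal x≡c = subst (s ≤_) (sym σxπᵢ≡xᵢ) s≤xᵢ
        where
        open ≡-Reasoning
        x≐ : x ≐ copow i s
        x≐ = subst (_≐ copow i s) (sym x≡c) (proj₂ c)
        σxπᵢ≡xᵢ : exp (to x) (π i) ≡ exp x i
        σxπᵢ≡xᵢ = begin
          exp (to x) (π i)    ≡⟨ σ-copow 0<s s≤α x≐ (π i) ⟩
          copow (π i) s (π i) ≡⟨ copow-self (π i) {s} ⟩
          α (π i) ∸ s         ≡⟨ cong (_∸ s) (α∘π i) ⟩
          α i ∸ s             ≡⟨ sym (copow-self i {s}) ⟩
          copow i s i         ≡⟨ sym (x≐ i) ⟩
          exp x i             ∎

    exp≤exp∘σ : ∀ x i → exp x i ≤ exp (to x) (π i)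
    exp≤exp∘σ x i with 0 <? exp x i
    ... | yes 0<xᵢ = ≤exp⇒≤exp∘σ 0<xᵢ ≤-refl
    ... | no xᵢ≯0 = ≤-trans (≮⇒≥ xᵢ≯0) z≤n

  module Action (σ : Automorphism) where
    open Automorphism σ
    open Coordinates σ public
    open Coordinates (σ ⁻¹) using () renaming (exp≤exp∘σ to exp≤exp∘σ⁻¹)

    exp∘σ : ∀ x i → exp (to x) (π i) ≡ exp x i
    exp∘σ x i = ≤-antisym
      (subst (exp (to x) (π i) ≤_) (cong₂ exp (from-to x) (π⁻¹-π i)) (exp≤exp∘σ⁻¹ (to x) (π i)))
      (exp≤exp∘σ x i)

    π-unique : (ρ : Fin k → Fin k) → ∀ i → (∀ x → exp (to x) (ρ i) ≡ exp x i) → ρ i ≡ π i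
    π-unique ρ i exp∘σ≡ with ρ i ≟ᶠ π i
    ... | yes ρi≡πi = ρi≡πi
    ... | no ρi≢πi = contradiction (begin
        0                              ≡⟨ sym (pow-other ρi≢πi) ⟩
        pow (π i) 1 (ρ i)              ≡⟨ sym (σ-pow1 pᵢ≐ (ρ i)) ⟩
        exp (to (proj₁ (pow1 i))) (ρ i) ≡⟨ exp∘σ≡ _ ⟩
        exp (proj₁ (pow1 i)) i          ≡⟨ pᵢ≐ i ⟩
        pow i 1 i                      ≡⟨ pow-self i ⟩
        1                              ∎) λ ()
      where
      open ≡-Reasoning
      pᵢ≐ = proj₂ (pow1 i)

  module Relabel (g h : Fin k → Fin k) (g∘h : ∀ j → g (h j) ≡ j) (α∘g : ∀ j → α (g j) ≡ α j) where

    relabel : V → V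
    relabel x = vertex (exp x ∘ g) (λ j → subst (exp x (g j) ≤_) (α∘g j) (exp≤α x (g j)))
      (let i , 0<xᵢ = exp-nonzero x in h i , subst (λ l → 0 < exp x l) (sym (g∘h i)) 0<xᵢ)
      (let i , xᵢ<αᵢ = exp-nonfull x in
        h i , subst₂ (λ l a → exp x l < a) (sym (g∘h i)) (trans (cong α (sym (g∘h i))) (α∘g (h i))) xᵢ<αᵢ)

    exp-relabel : ∀ x j → exp (relabel x) j ≡ exp x (g j)
    exp-relabel x = exp-vertex _ _ _ _

    relabel-~ : ∀ {u v} → u ~ v → relabel u ~ relabel v
    relabel-~ {u} {v} u~v = covers⇒~ relabel-u≢v λ j →
      subst₂ _≤_ (α∘g j) (sym (cong₂ _+_ (exp-relabel u j) (exp-relabel v j))) (~⇒covers u~v (g j))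
      where
      relabel-u≢v : relabel u ≢ relabel v
      relabel-u≢v eq = ~⇒≢ u~v (exp-injective λ l → begin
        exp u l               ≡⟨ cong (exp u) (sym (g∘h l)) ⟩
        exp u (g (h l))       ≡⟨ sym (exp-relabel u (h l)) ⟩
        exp (relabel u) (h l) ≡⟨ cong (λ z → exp z (h l)) eq ⟩
        exp (relabel v) (h l) ≡⟨ exp-relabel v (h l) ⟩
        exp v (g (h l))       ≡⟨ cong (exp v) (g∘h l) ⟩
        exp v l               ∎)
        where open ≡-Reasoning

  module _ (ρ : Fin k ↔ Fin k) (α∘ρ : ∀ j → α (Inverse.to ρ j) ≡ α j) where
    open Inverse ρ

    private
      α∘ρ⁻¹ : ∀ j → α (from j) ≡ α j
      α∘ρ⁻¹ j = trans (sym (α∘ρ (from j))) (cong α (strictlyInverseˡ j))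

      module Forward = Relabel from to strictlyInverseʳ α∘ρ⁻¹
      module Backward = Relabel to from strictlyInverseˡ α∘ρ

    permutationAutomorphism : Automorphism
    permutationAutomorphism = record
      { to = Forward.relabel
      ; from = Backward.relabel
      ; to-from = λ x → exp-injective λ j →
          trans (Forward.exp-relabel _ j) (trans (Backward.exp-relabel x _) (cong (exp x) (strictlyInverseˡ j)))
      ; from-to = λ x → exp-injective (Backward-Forward x)
      ; to-~ = Forward.relabel-~
      ; to-~⁻¹ = λ {u} {v} Fu~Fv →
          subst₂ _~_ (exp-injective (Backward-Forward u)) (exp-injective (Backward-Forward v))
                     (Backward.relabel-~ Fu~Fv)
      }
      where
      Backward-Forward : ∀ x j → exp (Backward.relabel (Forward.relabel x)) j ≡ exp x j
      Backward-Forward x j =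
        trans (Backward.exp-relabel _ j) (trans (Forward.exp-relabel x _) (cong (exp x) (strictlyInverseʳ j)))

    exp-permutationAutomorphism : ∀ x j → exp (Automorphism.to permutationAutomorphism x) (to j) ≡ exp x j
    exp-permutationAutomorphism x j = trans (Forward.exp-relabel x (to j)) (cong (exp x) (strictlyInverseʳ j))

suc-Σ : ∀ {m} {A : Set} {P : A → Set} {f : Fin (suc m) → A} → Σ (Fin m) (P ∘ f ∘ suc) → Σ (Fin (suc m)) (P ∘ f)
suc-Σ (j , q) = suc j , q

filter-tabulate-↔ : ∀ {m} {A : Set} {P : A → Set} (P? : Decidable P) →
                    (∀ {x} (p q : P x) → p ≡ q) → (f : Fin m → A) →
                    Fin (length (filter P? (tabulate f))) ↔ Σ (Fin m) (P ∘ f)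
filter-tabulate-↔ {zero} P? P-irr f = mk↔ₛ′ (λ ()) (λ ()) (λ ()) (λ ())
filter-tabulate-↔ {suc m} {P = P} P? P-irr f with P? (f zero) | filter-tabulate-↔ P? P-irr (f ∘ suc)
... | yes p | ih = mk↔ₛ′ to from to-from from-to
  where
  open Inverse ih renaming (to to to′; from to from′)
  to : _ → Σ (Fin (suc m)) (P ∘ f)
  to zero = zero , p
  to (suc x) = suc-Σ {P = P} {f = f} (to′ x)
  from : Σ (Fin (suc m)) (P ∘ f) → _
  from (zero , _) = zero
  from (suc j , q) = suc (from′ (j , q))
  to-from : ∀ y → to (from y) ≡ y
  to-from (zero , q) = cong (zero ,_) (P-irr p q)
  to-from (suc j , q) = cong (suc-Σ {P = P} {f = f}) (strictlyInverseˡ (j , q))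
  from-to : ∀ x → from (to x) ≡ x
  from-to zero = refl
  from-to (suc x) = cong suc (strictlyInverseʳ x)
... | no ¬p | ih = mk↔ₛ′ to from to-from from-to
  where
  open Inverse ih renaming (to to to′; from to from′)
  to : _ → Σ (Fin (suc m)) (P ∘ f)
  to x = suc-Σ {P = P} {f = f} (to′ x)
  from : Σ (Fin (suc m)) (P ∘ f) → _
  from (zero , p) = contradiction p ¬p
  from (suc j , q) = from′ (j , q)
  to-from : ∀ y → to (from y) ≡ y
  to-from (zero , p) = contradiction p ¬p
  to-from (suc j , q) = cong (suc-Σ {P = P} {f = f}) (strictlyInverseˡ (j , q))
  from-to : ∀ x → from (to x) ≡ x
  from-to x = strictlyInverseʳ x

module Classification {k} {α : Fin k → ℕ} {n : ℕ} (G : ExponentGraph α (Vertex n) (Adj n))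
  (other : Fin k → Fin k) (other≢ : ∀ i → other i ≢ i) (α-positive : ∀ i → 0 < α i)
  (not-p²q : ∀ i j → i ≢ j → (∀ l → l ≡ i ⊎ l ≡ j) → α i ≡ 2 → α j ≡ 1 → ⊥)
  {b} (r : Fin b → Fin k) (r-inj : Injective _≡_ _≡_ (α ∘ r)) (r-cover : ∀ j → ∃[ i ] α j ≡ α (r i)) where

  open ExponentGraph G
  open Rigidity G other other≢ α-positive not-p²q
  open Inverse

  automorphism : Aut n → Automorphism
  automorphism f = record
    { to = Aut.to f ; from = Aut.from f ; to-from = Aut.to-from f ; from-to = Aut.from-to f
    ; to-~ = λ {u} {v} → Equivalence.to (Aut.preserve f u v)
    ; to-~⁻¹ = λ {u} {v} → Equivalence.from (Aut.preserve f u v)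
    }

  fromAutomorphism : Automorphism → Aut n
  fromAutomorphism σ = record
    { to = A.to ; from = A.from ; to-from = A.to-from ; from-to = A.from-to
    ; preserve = λ u v → mk⇔ A.to-~ A.to-~⁻¹
    }
    where module A = Automorphism σ

  Π : Aut n → Fin k → Fin k
  Π f = Action.π (automorphism f)

  exp∘Π : ∀ f x j → exp (Aut.to f x) (Π f j) ≡ exp x j
  exp∘Π f = Action.exp∘σ (automorphism f)

  Π-unique : ∀ f (ρ : Fin k → Fin k) → (∀ x j → exp (Aut.to f x) (ρ j) ≡ exp x j) → ∀ j → Π f j ≡ ρ j
  Π-unique f ρ exp∘ρ j = sym (Action.π-unique (automorphism f) ρ j (λ x → exp∘ρ x j))

  Π-∘ : ∀ f g j → Π (f ∘ᴬ g) j ≡ Π f (Π g j)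
  Π-∘ f g = Π-unique (f ∘ᴬ g) (Π f ∘ Π g) λ x j → trans (exp∘Π f (Aut.to g x) (Π g j)) (exp∘Π g x j)

  Π-determines : ∀ f g → (∀ j → Π f j ≡ Π g j) → f ≈ᴬ g
  Π-determines f g Πf≗Πg v = exp-injective λ l → begin
    exp (Aut.to f v) l            ≡⟨ cong (exp (Aut.to f v)) (sym (π-π⁻¹ l)) ⟩
    exp (Aut.to f v) (Π f (π⁻¹ l)) ≡⟨ exp∘Π f v (π⁻¹ l) ⟩
    exp v (π⁻¹ l)                  ≡⟨ sym (exp∘Π g v (π⁻¹ l)) ⟩
    exp (Aut.to g v) (Π g (π⁻¹ l)) ≡⟨ cong (exp (Aut.to g v)) (trans (sym (Πf≗Πg (π⁻¹ l))) (π-π⁻¹ l)) ⟩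
    exp (Aut.to g v) l            ∎
    where
    open ≡-Reasoning
    open Action (automorphism f) using (π⁻¹; π-π⁻¹)

  Fibre : ℕ → Set
  Fibre a = Σ (Fin k) (λ j → α j ≡ a)

  fibre-≡ : ∀ {a} {x y : Fibre a} → proj₁ x ≡ proj₁ y → x ≡ y
  fibre-≡ {x = j , e} {.j , e′} refl = cong (j ,_) (≡-irrelevant e e′)

  restrict : (ρ : Fin k → Fin k) → (∀ j → α (ρ j) ≡ α j) → ∀ {a} → Fibre a → Fibre a
  restrict ρ α∘ρ (j , e) = ρ j , trans (α∘ρ j) e

  fibrePermutation : Automorphism → ∀ a → Fibre a ↔ Fibre a
  fibrePermutation σ a = mk↔ₛ′ (restrict π α∘π) (restrict π⁻¹ α∘π⁻¹)
    (λ _ → fibre-≡ (π-π⁻¹ _)) (λ _ → fibre-≡ (π⁻¹-π _))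
    where
    open Action σ
    open Action (σ ⁻¹) using () renaming (α∘π to α∘π⁻¹)

  ks : Fin b → ℕ
  ks i = multiplicity α (α (r i))

  ι : ∀ i → Fin (ks i) ↔ Fibre (α (r i))
  ι i = filter-tabulate-↔ (λ j → α j ≟ α (r i)) ≡-irrelevant id

  φ : Aut n → SymProd b ks
  φ f i = ↔-sym (ι i) ↔-∘ (fibrePermutation (automorphism f) (α (r i)) ↔-∘ ι i)

  φ-cong : ∀ f g → f ≈ᴬ g → φ f ≈ˢ φ g
  φ-cong f g f≈g i x = cong (from (ι i)) (fibre-≡ (Π-unique f (Π g) exp∘Πg _))
    where
    exp∘Πg : ∀ y j → exp (Aut.to f y) (Π g j) ≡ exp y j
    exp∘Πg y j = trans (cong (λ z → exp z (Π g j)) (f≈g y)) (exp∘Π g y j)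

  φ-hom : ∀ f g → φ (f ∘ᴬ g) ≈ˢ-∘ φ f , φ g
  φ-hom f g i x =
    cong (from (ι i)) (fibre-≡ (trans (Π-∘ f g _) (cong (Π f ∘ proj₁) (sym (strictlyInverseˡ (ι i) _)))))

  class : Fin k → Fin b
  class j = proj₁ (r-cover j)

  class-spec : ∀ j → α j ≡ α (r (class j))
  class-spec j = proj₂ (r-cover j)

  Π-via-φ : ∀ f j → Π f j ≡ proj₁ (to (ι (class j)) (to (φ f (class j)) (from (ι (class j)) (j , class-spec j))))
  Π-via-φ f j = sym (trans (cong proj₁ (strictlyInverseˡ (ι i) _))
                           (cong (Π f ∘ proj₁) (strictlyInverseˡ (ι i) (j , class-spec j))))
    where i = class j

  φ-injective : ∀ f g → φ f ≈ˢ φ g → f ≈ᴬ g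
  φ-injective f g φf≈φg = Π-determines f g λ j →
    trans (Π-via-φ f j) (trans (cong (proj₁ ∘ to (ι _)) (φf≈φg _ _)) (sym (Π-via-φ g j)))

  glue : ((i : Fin b) → Fin (ks i) → Fin (ks i)) → Fin k → Fin k
  glue τ j = proj₁ (to (ι (class j)) (τ (class j) (from (ι (class j)) (j , class-spec j))))

  α∘glue : ∀ τ j → α (glue τ j) ≡ α j
  α∘glue τ j = trans (proj₂ (to (ι (class j)) _)) (sym (class-spec j))

  glue-ι : ∀ τ i y → glue τ (proj₁ (to (ι i) y)) ≡ proj₁ (to (ι i) (τ i y))
  glue-ι τ i y = at-class (class j) (r-inj (trans (sym (class-spec j)) (proj₂ (to (ι i) y)))) (class-spec j)
    where
    j = proj₁ (to (ι i) y)
    at-class : ∀ c → c ≡ i → (e : α j ≡ α (r c)) →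
               proj₁ (to (ι c) (τ c (from (ι c) (j , e)))) ≡ proj₁ (to (ι i) (τ i y))
    at-class _ refl e = cong (λ z → proj₁ (to (ι i) (τ i z)))
                             (trans (cong (from (ι i)) (fibre-≡ refl)) (strictlyInverseʳ (ι i) y))

  glue-inverse : ∀ τ τ′ → (∀ i y → τ′ i (τ i y) ≡ y) → ∀ j → glue τ′ (glue τ j) ≡ j
  glue-inverse τ τ′ τ′∘τ j = trans (glue-ι τ′ i (τ i y))
    (trans (cong (proj₁ ∘ to (ι i)) (τ′∘τ i y)) (cong proj₁ (strictlyInverseˡ (ι i) (j , class-spec j))))
    where
    i = class j
    y = from (ι i) (j , class-spec j)

  glued : SymProd b ks → Fin k ↔ Fin k
  glued s = mk↔ₛ′ (glue (λ i → to (s i))) (glue (λ i → from (s i)))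
    (glue-inverse (λ i → from (s i)) (λ i → to (s i)) (λ i → strictlyInverseˡ (s i)))
    (glue-inverse (λ i → to (s i)) (λ i → from (s i)) (λ i → strictlyInverseʳ (s i)))

  φ-surjective : ∀ s → Σ[ f ∈ Aut n ] φ f ≈ˢ s
  φ-surjective s = f , φf≈s
    where
    α∘glued = α∘glue (λ i → to (s i))
    f = fromAutomorphism (permutationAutomorphism (glued s) α∘glued)
    Πf≗ : ∀ j → Π f j ≡ glue (λ i → to (s i)) j
    Πf≗ = Π-unique f _ (exp-permutationAutomorphism (glued s) α∘glued)
    φf≈s : φ f ≈ˢ s
    φf≈s i x = trans (cong (from (ι i)) (fibre-≡ (trans (Πf≗ _) (glue-ι (λ i → to (s i)) i x))))
                     (strictlyInverseʳ (ι i) _)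

  iso : AutIsoSymProd n b ks
  iso = record
    { φ = φ ; φ-cong = φ-cong ; φ-injective = φ-injective ; φ-surjective = φ-surjective ; φ-hom = φ-hom }

other : ∀ {k} → Fin (suc (suc k)) → Fin (suc (suc k))
other zero = suc zero
other (suc _) = zero

other≢ : ∀ {k} (i : Fin (suc (suc k))) → other i ≢ i
other≢ zero ()
other≢ (suc _) ()

only-two : ∀ {k} → (∀ (l : Fin (suc (suc k))) → l ≡ zero ⊎ l ≡ suc zero) → k ≡ 0
only-two {zero} _ = refl
only-two {suc k} cover with cover (suc (suc zero))
... | inj₁ ()
... | inj₂ ()

p²q-excluded : ∀ {k n} {p α : Fin (suc (suc k)) → ℕ} → n ≡ p ^ᵛ α →
          (∀ (i j : Fin (suc (suc k))) → toℕ i ≤ toℕ j → α j ≤ α i) →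
          (∀ (i j : Fin (suc (suc k))) → toℕ i ≡ 0 → toℕ j ≡ 1 → n ≢ p i ^ 2 * p j) →
          ∀ i j → i ≢ j → (∀ l → l ≡ i ⊎ l ≡ j) → α i ≡ 2 → α j ≡ 1 → ⊥
p²q-excluded {k} {n} {p} {α} n≡p^α α-antitone n≢p²q i j i≢j cover αᵢ≡2 αⱼ≡1 with cover zero | cover (suc zero)
... | inj₁ refl | inj₁ ()
... | inj₂ refl | inj₂ ()
... | inj₂ refl | inj₁ refl =
  contradiction (subst₂ _≤_ αᵢ≡2 αⱼ≡1 (α-antitone zero (suc zero) z≤n)) λ { (s≤s ()) }
... | inj₁ refl | inj₂ refl with only-two cover
...   | refl = n≢p²q zero (suc zero) refl refl n≡p₀²p₁
  where
  open ≡-Reasoning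
  n≡p₀²p₁ : n ≡ p zero ^ 2 * p (suc zero)
  n≡p₀²p₁ = begin
    n                                                   ≡⟨ n≡p^α ⟩
    p zero ^ α zero * (p (suc zero) ^ α (suc zero) * 1)
      ≡⟨ cong₂ (λ a c → p zero ^ a * (p (suc zero) ^ c * 1)) αᵢ≡2 αⱼ≡1 ⟩
    p zero ^ 2 * (p (suc zero) * 1 * 1)
      ≡⟨ cong (p zero ^ 2 *_) (trans (*-identityʳ _) (*-identityʳ _)) ⟩
    p zero ^ 2 * p (suc zero)                           ∎

proposition4p8 :
  (n k : ℕ) → 2 ≤ k →
  (p α : Fin k → ℕ) →
  (∀ i → Prime (p i)) →
  Injective _≡_ _≡_ p →
  (∀ i → 1 ≤ α i) →
  (∀ (i j : Fin k) → toℕ i ≤ toℕ j → α j ≤ α i) →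
  n ≡ product (map (λ i → p i ^ α i) (allFin k)) →
  (∀ (i j : Fin k) → toℕ i ≡ 0 → toℕ j ≡ 1 → n ≢ p i ^ 2 * p j) →
  (b : ℕ) (r : Fin b → Fin k) →
  Injective _≡_ _≡_ (λ i → α (r i)) →
  (∀ (j : Fin k) → ∃[ i ] α j ≡ α (r i)) →
  AutIsoSymProd n b (λ i → multiplicity α (α (r i)))
proposition4p8 n (suc (suc k)) (s≤s (s≤s z≤n)) p α p-prime p-inj α-positive α-antitone n≡∏ n≢p²q
               b r r-inj r-cover =
  Classification.iso (DivisorExponents.exponentGraph p-prime p-inj n≡p^α) other other≢ α-positive
    (p²q-excluded {p = p} n≡p^α α-antitone n≢p²q) r r-inj r-cover
  where
  n≡p^α : n ≡ p ^ᵛ α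
  n≡p^α = trans n≡∏ (product-map-allFin (λ i → p i ^ α i))
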